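{- Let $P(X)\in\mathbb{Z}[X]$ be monic, irreducible, of degree $4$, with Galois group $C_4$ or $D_4$, and let $r_1,r_2,r_3,r_4$ be its roots ordered so that $r_1r_2+r_3r_4\in\mathbb{Q}$. Then $1$, $r_1+r_3$, $r_1^2+r_3^2+r_1r_3$ are linearly independent over $\mathbb{Q}$. -}

module Defs where

open import Level using (Level; _⊔_)
open import Data.Nat as ℕ using (ℕ; zero; suc; _∸_)
open import Data.Nat.DivMod using (_mod_)
open import Data.Fin using (Fin; toℕ)
open import Data.Fin.Permutation using (Permutation′; _⟨$⟩ʳ_)
open import Data.Bool using (Bool; true; false; not)
open import Data.Product using (Σ; ∃; _×_; _,_)
open import Data.Sum using (_⊎_)
open import Data.List using (List; []; _∷_; map; foldr; upTo)
open import Data.Integer using (ℤ)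
open import Data.Rational as ℚ using (ℚ; 0ℚ; 1ℚ)
import Data.Rational.Properties as ℚP
open import Algebra.Bundles using (CommutativeRing)
open import Algebra.Morphism.Structures using (module RingMorphisms)
open import Relation.Nullary using (¬_)
open import Relation.Binary.PropositionalEquality using (_≡_)
open import Function using (_∘_)

-- Univariate polynomials over ℚ as coefficient lists (lowest degree first)

Polyℚ : Set
Polyℚ = List ℚ

coeff : Polyℚ → ℕ → ℚ
coeff []       _       = 0ℚ
coeff (a ∷ _)  zero    = a
coeff (_ ∷ as) (suc n) = coeff as n

coeffMul : Polyℚ → Polyℚ → ℕ → ℚ
coeffMul f g n = foldr ℚ._+_ 0ℚ (map (λ i → coeff f i ℚ.* coeff g (n ∸ i)) (upTo (suc n)))

-- constant polynomial (degree ≤ 0); over the field ℚ the units of ℚ[X]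
-- are the non-zero constants
IsConstant : Polyℚ → Set
IsConstant f = ∀ n → coeff f (suc n) ≡ 0ℚ

Irreducibleℚ : Polyℚ → Set
Irreducibleℚ p = ¬ IsConstant p
  × (∀ f g → (∀ n → coeffMul f g n ≡ coeff p n) → IsConstant f ⊎ IsConstant g)

quartic : ℤ → ℤ → ℤ → ℤ → Polyℚ
quartic a0 a1 a2 a3 = ℚ._/_ a0 1 ∷ ℚ._/_ a1 1 ∷ ℚ._/_ a2 1 ∷ ℚ._/_ a3 1 ∷ 1ℚ ∷ []

IsField : ∀ {c ℓ} → CommutativeRing c ℓ → Set (c ⊔ ℓ)
IsField K = ¬ (1# ≈ 0#) × (∀ x → ¬ (x ≈ 0#) → ∃ λ y → x * y ≈ 1#)
  where open CommutativeRing K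

-- ring homomorphism ℚ → K (its existence makes K a field containing ℚ, i.e.
-- a field of characteristic 0)
IsRingHomFromℚ : ∀ {c ℓ} (K : CommutativeRing c ℓ) → (ℚ → CommutativeRing.Carrier K) → Set ℓ
IsRingHomFromℚ K ι = IsRingHomomorphism ι
  where open RingMorphisms (CommutativeRing.rawRing ℚP.+-*-commutativeRing)
                           (CommutativeRing.rawRing K)

data Expr : Set where
  const : ℚ → Expr
  var   : Fin 4 → Expr
  _⊕_   : Expr → Expr → Expr
  _⊗_   : Expr → Expr → Expr

eval : ∀ {c ℓ} (K : CommutativeRing c ℓ) → (ℚ → CommutativeRing.Carrier K)
     → (Fin 4 → CommutativeRing.Carrier K) → Expr → CommutativeRing.Carrier K
eval K ι r (const q) = ι q
eval K ι r (var i)   = r i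
eval K ι r (e ⊕ f)   = CommutativeRing._+_ K (eval K ι r e) (eval K ι r f)
eval K ι r (e ⊗ f)   = CommutativeRing._*_ K (eval K ι r e) (eval K ι r f)

-- Galois group of the polynomial with roots r, realised (as usual) as the
-- group of permutations σ of the roots preserving every algebraic relation
-- over ℚ among the roots: F(r₀,…,r₃) = 0 ⇒ F(r_{σ 0},…,r_{σ 3}) = 0.
InGal : ∀ {c ℓ} (K : CommutativeRing c ℓ) → (ℚ → CommutativeRing.Carrier K)
      → (Fin 4 → CommutativeRing.Carrier K) → Permutation′ 4 → Set ℓ
InGal K ι r σ = ∀ e → eval K ι r e ≈ 0# → eval K ι (r ∘ (σ ⟨$⟩ʳ_)) e ≈ 0#
  where open CommutativeRing K

_+₄_ : Fin 4 → Fin 4 → Fin 4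
a +₄ b = (toℕ a ℕ.+ toℕ b) mod 4

_-₄_ : Fin 4 → Fin 4 → Fin 4
a -₄ b = (toℕ a ℕ.+ (4 ∸ toℕ b)) mod 4

C4op : Fin 4 → Fin 4 → Fin 4
C4op = _+₄_

-- D₄ (order 8): (a , s) stands for ρ^a σ^s, with ρ⁴ = σ² = 1, σρσ = ρ⁻¹
D4op : Fin 4 × Bool → Fin 4 × Bool → Fin 4 × Bool
D4op (a , false) (b , t) = (a +₄ b , t)
D4op (a , true)  (b , t) = (a -₄ b , not t)

GalIso : ∀ {c ℓ} (K : CommutativeRing c ℓ) → (ℚ → CommutativeRing.Carrier K)
       → (Fin 4 → CommutativeRing.Carrier K) → (G : Set) → (G → G → G) → Set ℓ
GalIso K ι r G op = Σ (G → Permutation′ 4) λ φ →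
    (∀ x y i → φ (op x y) ⟨$⟩ʳ i ≡ φ y ⟨$⟩ʳ (φ x ⟨$⟩ʳ i))
  × (∀ x y → (∀ i → φ x ⟨$⟩ʳ i ≡ φ y ⟨$⟩ʳ i) → x ≡ y)
  × (∀ x → InGal K ι r (φ x))
  × (∀ σ → InGal K ι r σ → ∃ λ x → ∀ i → φ x ⟨$⟩ʳ i ≡ σ ⟨$⟩ʳ i)

-- An element σ of order 4 of the Galois group (both C₄ and D₄ contain one) permutes the roots
-- as a 4-cycle and preserves every polynomial relation over ℚ among them.  Listing the roots
-- along the cycle as u₀, u₁, u₂, u₃, σ acts as u₀ ↦ u₁ ↦ u₂ ↦ u₃ ↦ u₀.  If u₀ = u₂ and u₁ = u₃
-- the quartic would be the square of a quadratic over ℚ, so by irreducibility, and applying σ,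
-- the uᵢ are pairwise distinct.  The pairings {{u₀,u₁},{u₂,u₃}} and {{u₁,u₂},{u₃,u₀}} are
-- swapped by σ and their sums of products differ by (u₀ − u₂)(u₁ − u₃) ≠ 0, so neither sum is
-- rational.  Hence r₁r₂ + r₃r₄ ∈ ℚ forces {{r₁,r₂},{r₃,r₄}} = {{u₀,u₂},{u₁,u₃}}, and r₁, r₃ are
-- neighbours on the cycle, say u₀, u₁.  Applying σ to f(u₀,u₁) = a + b(u₀+u₁) + c(u₀²+u₁²+u₀u₁) = 0
-- and subtracting gives (u₀ − u₂)(b + c(u₀+u₁+u₂)) = 0; doing it once more gives c(u₀ − u₃) = 0.
-- So c = 0, then b = 0 and a = 0.

{-# OPTIONS --safe #-}
module Submission where

open import Defs
open import Level using (Level)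
open import Data.Fin using (Fin) renaming (zero to fz; suc to fs)
open import Data.Bool using (Bool)
open import Data.Product using (_×_; ∃)
open import Data.Sum using (_⊎_)
open import Data.Integer using (ℤ)
open import Data.Rational using (ℚ; 0ℚ)
open import Algebra.Bundles using (CommutativeRing)
open import Relation.Binary.PropositionalEquality using (_≡_)

open import Algebra.Morphism.Structures using (module RingMorphisms)
import Algebra.Properties.Ring as RingProperties
import Algebra.Solver.Ring
import Algebra.Solver.Ring.AlmostCommutativeRing as ACR
open import Data.Bool using (false)
open import Data.Empty using (⊥; ⊥-elim)
open import Data.Fin.Patterns using (0F; 1F; 2F; 3F)
open import Data.Fin.Permutation using (_⟨$⟩ʳ_; _⟨$⟩ˡ_; inverseˡ)
open import Data.Fin.Properties using (all?) renaming (_≟_ to _≟ᶠ_)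
open import Data.List using (List; []; _∷_; foldr; map; upTo)
open import Data.List.Relation.Unary.Any using (here; there)
open import Data.Maybe using (Maybe; just; nothing)
open import Data.Nat using (ℕ; suc; _∸_)
open import Data.Product using (_,_; proj₁; proj₂)
open import Data.Product.Properties using (≡-dec)
open import Data.Rational using (1ℚ; ½)
import Data.Rational as ℚ
import Data.Rational.Properties as ℚₚ
open import Data.Rational.Solver using (module +-*-Solver)
open import Data.Sum using (inj₁; inj₂; [_,_]′)
open import Data.Vec using (_∷_; []; lookup; tabulate)
open import Data.Vec.Properties using (lookup∘tabulate)
open import Function using (_∘_; id)
open import Relation.Binary.Definitions using (DecidableEquality)
import Relation.Binary.PropositionalEquality as ≡
open ≡ using (_≗_; _≢_; cong; cong₂; subst)
open import Relation.Nullary using (¬_; yes; no; ¬?)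
open import Relation.Nullary.Decidable using (_×-dec_; _→-dec_; from-yes; decidable-stable)

quadratic : ℚ → ℚ → Polyℚ
quadratic s p = p ∷ ℚ.- s ∷ 1ℚ ∷ []

quadratic² : ℚ → ℚ → Polyℚ
quadratic² s p =
  p ℚ.* p ∷ ℚ.- ((s ℚ.+ s) ℚ.* p) ∷ s ℚ.* s ℚ.+ (p ℚ.+ p) ∷ ℚ.- (s ℚ.+ s) ∷ 1ℚ ∷ []

sum-zeros : ∀ (f : ℕ → ℚ) → (∀ i → f i ≡ 0ℚ) → ∀ is → foldr ℚ._+_ 0ℚ (map f is) ≡ 0ℚ
sum-zeros f f≡0 []       = ≡.refl
sum-zeros f f≡0 (i ∷ is) = cong₂ ℚ._+_ (f≡0 i) (sum-zeros f f≡0 is)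

coeffMul-quadratic : ∀ s p n →
  coeffMul (quadratic s p) (quadratic s p) n ≡ coeff (quadratic² s p) n
coeffMul-quadratic s p 0 = ℚₚ.+-identityʳ (p ℚ.* p)
coeffMul-quadratic s p 1 =
  solve 2 (λ s p → p :* :- s :+ (:- s :* p :+ con 0ℚ) := :- ((s :+ s) :* p)) ≡.refl s p
  where open +-*-Solver
coeffMul-quadratic s p 2 =
  solve 2 (λ s p → p :* con 1ℚ :+ (:- s :* :- s :+ (con 1ℚ :* p :+ con 0ℚ)) := s :* s :+ (p :+ p)) ≡.refl s p
  where open +-*-Solver
coeffMul-quadratic s p 3 =
  solve 2 (λ s p → p :* con 0ℚ :+ (:- s :* con 1ℚ :+ (con 1ℚ :* :- s :+ (con 0ℚ :* p :+ con 0ℚ)))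
                   := :- (s :+ s)) ≡.refl s p
  where open +-*-Solver
coeffMul-quadratic s p 4 =
  solve 2 (λ s p → p :* con 0ℚ :+ (:- s :* con 0ℚ :+ (con 1ℚ :* con 1ℚ :+
                     (con 0ℚ :* :- s :+ (con 0ℚ :* p :+ con 0ℚ))))
                   := con 1ℚ) ≡.refl s p
  where open +-*-Solver
coeffMul-quadratic s p n@(suc (suc (suc (suc (suc m))))) = sum-zeros _ vanishes (upTo (suc n))
  where
  vanishes : ∀ i → coeff (quadratic s p) i ℚ.* coeff (quadratic s p) (n ∸ i) ≡ 0ℚ
  vanishes 0                   = ℚₚ.*-zeroʳ p
  vanishes 1                   = ℚₚ.*-zeroʳ (ℚ.- s)
  vanishes 2                   = ℚₚ.*-zeroʳ 1ℚ
  vanishes (suc (suc (suc i))) = ℚₚ.*-zeroˡ (coeff (quadratic s p) (suc (suc m) ∸ i))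

¬irreducible-quadratic² : ∀ s p → ¬ Irreducibleℚ (quadratic² s p)
¬irreducible-quadratic² s p (_ , factors) =
  [ nonconstant , nonconstant ]′ (factors (quadratic s p) (quadratic s p) (coeffMul-quadratic s p))
  where
  nonconstant : ¬ IsConstant (quadratic s p)
  nonconstant constant = ℚₚ.1≢0 (constant 1)

data FourCycle : Fin 4 → Fin 4 → Fin 4 → Set where
  ⟨0123⟩ : FourCycle 1F 2F 3F
  ⟨0132⟩ : FourCycle 1F 3F 2F
  ⟨0213⟩ : FourCycle 2F 1F 3F
  ⟨0231⟩ : FourCycle 2F 3F 1F
  ⟨0312⟩ : FourCycle 3F 1F 2F
  ⟨0321⟩ : FourCycle 3F 2F 1F

listing : Fin 4 → Fin 4 → Fin 4 → Fin 4 → Fin 4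
listing a b c = lookup (0F ∷ a ∷ b ∷ c ∷ [])

rotate : Fin 4 → Fin 4
rotate = lookup (1F ∷ 2F ∷ 3F ∷ 0F ∷ [])

HasOrder4 : (Fin 4 → Fin 4) → Set
HasOrder4 σ = (σ ∘ σ) ∘ (σ ∘ σ) ≗ id × ¬ (σ ∘ σ ≗ id)

order4⇒conjugate : ∀ σ → HasOrder4 σ →
  let a = σ 0F ; b = σ a ; c = σ b in σ ∘ listing a b c ≗ listing a b c ∘ rotate
order4⇒conjugate σ σ⁴≗id 0F = ≡.refl
order4⇒conjugate σ σ⁴≗id 1F = ≡.refl
order4⇒conjugate σ σ⁴≗id 2F = ≡.refl
order4⇒conjugate σ σ⁴≗id 3F = proj₁ σ⁴≗id 0F

private
  _≟_ : DecidableEquality (Fin 4)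
  _≟_ = _≟ᶠ_

open import Data.List.Membership.DecPropositional (≡-dec _≟_ (≡-dec _≟_ _≟_)) using (_∈_; _∈?_)

private
  fourCycles : List (Fin 4 × Fin 4 × Fin 4)
  fourCycles =
    (1F , 2F , 3F) ∷ (1F , 3F , 2F) ∷ (2F , 1F , 3F) ∷ (2F , 3F , 1F) ∷ (3F , 1F , 2F) ∷ (3F , 2F , 1F) ∷ []

  ∈⇒FourCycle : ∀ {a b c} → (a , b , c) ∈ fourCycles → FourCycle a b c
  ∈⇒FourCycle (here ≡.refl)                                         = ⟨0123⟩
  ∈⇒FourCycle (there (here ≡.refl))                                 = ⟨0132⟩
  ∈⇒FourCycle (there (there (here ≡.refl)))                         = ⟨0213⟩
  ∈⇒FourCycle (there (there (there (here ≡.refl))))                 = ⟨0231⟩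
  ∈⇒FourCycle (there (there (there (there (here ≡.refl)))))         = ⟨0312⟩
  ∈⇒FourCycle (there (there (there (there (there (here ≡.refl)))))) = ⟨0321⟩
  ∈⇒FourCycle (there (there (there (there (there (there ()))))))

  orbit : (Fin 4 → Fin 4) → Fin 4 × Fin 4 × Fin 4
  orbit σ = σ 0F , σ (σ 0F) , σ (σ (σ 0F))

  table : Fin 4 → Fin 4 → Fin 4 → Fin 4 → Fin 4 → Fin 4
  table a b c d = lookup (a ∷ b ∷ c ∷ d ∷ [])

  -- Decided by evaluation on all 4⁴ maps Fin 4 → Fin 4.
  order4-orbits : ∀ a b c d → HasOrder4 (table a b c d) → orbit (table a b c d) ∈ fourCycles
  order4-orbits = from-yes (all? λ a → all? λ b → all? λ c → all? λ d → let σ = table a b c d in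
    ((all? λ i → σ (σ (σ (σ i))) ≟ i) ×-dec ¬? (all? λ i → σ (σ i) ≟ i)) →-dec (orbit σ ∈? fourCycles))

  twice-cong : ∀ {σ τ : Fin 4 → Fin 4} → σ ≗ τ → σ ∘ σ ≗ τ ∘ τ
  twice-cong {σ} {τ} σ≗τ i = ≡.trans (σ≗τ (σ i)) (cong τ (σ≗τ i))

  HasOrder4-cong : ∀ {σ τ} → σ ≗ τ → HasOrder4 τ → HasOrder4 σ
  HasOrder4-cong σ≗τ (τ⁴≗id , τ²≉id) =
    (λ i → ≡.trans (twice-cong (twice-cong σ≗τ) i) (τ⁴≗id i)) ,
    (λ σ²≗id → τ²≉id λ i → ≡.trans (≡.sym (twice-cong σ≗τ i)) (σ²≗id i))

  orbit-cong : ∀ {σ τ} → σ ≗ τ → orbit σ ≡ orbit τ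
  orbit-cong {σ} {τ} σ≗τ =
    cong₂ _,_ (σ≗τ 0F) (cong₂ _,_ (twice-cong σ≗τ 0F) (≡.trans (σ≗τ _) (cong τ (twice-cong σ≗τ 0F))))

order4⇒fourCycle : ∀ σ → HasOrder4 σ → FourCycle (σ 0F) (σ (σ 0F)) (σ (σ (σ 0F)))
order4⇒fourCycle σ σ-order4 = ∈⇒FourCycle (subst (_∈ fourCycles) (orbit-cong table≗σ)
  (order4-orbits (σ 0F) (σ 1F) (σ 2F) (σ 3F) (HasOrder4-cong table≗σ σ-order4)))
  where
  table≗σ : table (σ 0F) (σ 1F) (σ 2F) (σ 3F) ≗ σ
  table≗σ = lookup∘tabulate σ

infixl 6 _+ᵉ_ _-ᵉ_
infixl 7 _*ᵉ_

_+ᵉ_ _-ᵉ_ _*ᵉ_ : Expr → Expr → Expr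
e +ᵉ f = e ⊕ f
e -ᵉ f = e +ᵉ const (ℚ.- 1ℚ) *ᵉ f
e *ᵉ f = e ⊗ f

X : Fin 4 → Expr
X = var

rename : (Fin 4 → Fin 4) → Expr → Expr
rename π (const q) = const q
rename π (var i)   = var (π i)
rename π (e ⊕ f)   = rename π e ⊕ rename π f
rename π (e ⊗ f)   = rename π e ⊗ rename π f

e₁ e₂ e₃ e₄ : Expr
e₁ = X 0F +ᵉ X 1F +ᵉ X 2F +ᵉ X 3F
e₂ = X 0F *ᵉ X 1F +ᵉ X 0F *ᵉ X 2F +ᵉ X 0F *ᵉ X 3F +ᵉ X 1F *ᵉ X 2F +ᵉ X 1F *ᵉ X 3F +ᵉ X 2F *ᵉ X 3F
e₃ = X 0F *ᵉ X 1F *ᵉ X 2F +ᵉ X 0F *ᵉ X 1F *ᵉ X 3F +ᵉ X 0F *ᵉ X 2F *ᵉ X 3F +ᵉ X 1F *ᵉ X 2F *ᵉ X 3F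
e₄ = X 0F *ᵉ X 1F *ᵉ X 2F *ᵉ X 3F

pairing : Fin 4 → Fin 4 → Fin 4 → Fin 4 → Expr
pairing i j k l = X i *ᵉ X j +ᵉ X k *ᵉ X l

combination : ℚ → ℚ → ℚ → Fin 4 → Fin 4 → Expr
combination a b c i j =
  const a +ᵉ const b *ᵉ (X i +ᵉ X j) +ᵉ const c *ᵉ (X i *ᵉ X i +ᵉ X j *ᵉ X j +ᵉ X i *ᵉ X j)

dividedDifference : ℚ → ℚ → Fin 4 → Fin 4 → Fin 4 → Expr
dividedDifference b c i j k = const b +ᵉ const c *ᵉ (X i +ᵉ X j +ᵉ X k)

module _ {c ℓ : Level} (K : CommutativeRing c ℓ) (ι : ℚ → CommutativeRing.Carrier K) where

  open CommutativeRing K using (Carrier; _≈_; 0#)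
  open ≡.≡-Reasoning

  Preserves : (Fin 4 → Carrier) → (Fin 4 → Fin 4) → Set ℓ
  Preserves u σ = ∀ e → eval K ι u e ≈ 0# → eval K ι (u ∘ σ) e ≈ 0#

  module _ {r : Fin 4 → Carrier} where

    order-4-element : ∀ {G : Set} {_∙_ : G → G → G} → GalIso K ι r G _∙_ → ∀ e g →
                      e ∙ e ≡ e → g ∙ g ≢ e → (g ∙ g) ∙ (g ∙ g) ≡ e → ∃ λ σ → Preserves r σ × HasOrder4 σ
    order-4-element {G} {_∙_} (φ , φ-hom , φ-injective , φ-galois , _) e g e∙e≡e g²≢e g⁴≡e =
      σ , φ-galois g , σ⁴≗id , σ²≉id
      where
      φ⟨_⟩ : G → Fin 4 → Fin 4
      φ⟨ x ⟩ = φ x ⟨$⟩ʳ_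

      σ : Fin 4 → Fin 4
      σ = φ⟨ g ⟩

      φ-cong : ∀ {x y} → x ≡ y → φ⟨ x ⟩ ≗ φ⟨ y ⟩
      φ-cong x≡y i = cong (λ x → φ⟨ x ⟩ i) x≡y

      φe≗id : φ⟨ e ⟩ ≗ id
      φe≗id i = begin
        φ⟨ e ⟩ i                     ≡⟨ inverseˡ (φ e) ⟨
        φ e ⟨$⟩ˡ φ⟨ e ⟩ (φ⟨ e ⟩ i)   ≡⟨ cong (φ e ⟨$⟩ˡ_) (φ-hom e e i) ⟨
        φ e ⟨$⟩ˡ φ⟨ e ∙ e ⟩ i        ≡⟨ cong (φ e ⟨$⟩ˡ_) (φ-cong e∙e≡e i) ⟩
        φ e ⟨$⟩ˡ φ⟨ e ⟩ i            ≡⟨ inverseˡ (φ e) ⟩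
        i                            ∎

      σ⁴≗id : (σ ∘ σ) ∘ (σ ∘ σ) ≗ id
      σ⁴≗id i = begin
        σ (σ (σ (σ i)))                       ≡⟨ φ-hom g g _ ⟨
        φ⟨ g ∙ g ⟩ (σ (σ i))                  ≡⟨ cong φ⟨ g ∙ g ⟩ (φ-hom g g i) ⟨
        φ⟨ g ∙ g ⟩ (φ⟨ g ∙ g ⟩ i)             ≡⟨ φ-hom (g ∙ g) (g ∙ g) i ⟨
        φ⟨ (g ∙ g) ∙ (g ∙ g) ⟩ i              ≡⟨ φ-cong g⁴≡e i ⟩
        φ⟨ e ⟩ i                              ≡⟨ φe≗id i ⟩
        i                                     ∎

      σ²≉id : ¬ (σ ∘ σ ≗ id)
      σ²≉id σ²≗id = g²≢e (φ-injective (g ∙ g) e λ i →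
        ≡.trans (φ-hom g g i) (≡.trans (σ²≗id i) (≡.sym (φe≗id i))))

    C4⊎D4⇒order-4-element : GalIso K ι r (Fin 4) C4op ⊎ GalIso K ι r (Fin 4 × Bool) D4op →
                            ∃ λ σ → Preserves r σ × HasOrder4 σ
    C4⊎D4⇒order-4-element =
      [ (λ gal → order-4-element gal 0F 1F ≡.refl (λ ()) ≡.refl)
      , (λ gal → order-4-element gal (0F , false) (1F , false) ≡.refl (λ ()) ≡.refl) ]′

module _ {c ℓ : Level} (K : CommutativeRing c ℓ) (K-field : IsField K)
         (ι : ℚ → CommutativeRing.Carrier K) (ι-hom : IsRingHomFromℚ K ι) where

  open CommutativeRing K
  open RingMorphisms.IsRingHomomorphism ι-hom using (+-homo; *-homo; -‿homo; 0#-homo; 1#-homo)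
  open RingProperties ring using (x∙y⁻¹≈ε⇒x≈y; x≈y⇒x∙y⁻¹≈ε; -‿involutive)
  open import Relation.Binary.Reasoning.Setoid setoid

  private
    ι-morphism : ACR._-Raw-AlmostCommutative⟶_ (CommutativeRing.rawRing ℚₚ.+-*-commutativeRing)
                                              (ACR.fromCommutativeRing K)
    ι-morphism = record
      { ⟦_⟧ = ι ; +-homo = +-homo ; *-homo = *-homo ; -‿homo = -‿homo ; 0-homo = 0#-homo ; 1-homo = 1#-homo }

    ι-equal? : ∀ u v → Maybe (ι u ≈ ι v)
    ι-equal? u v with u ℚₚ.≟ v
    ... | yes ≡.refl = just refl
    ... | no _       = nothing

  open Algebra.Solver.Ring (CommutativeRing.rawRing ℚₚ.+-*-commutativeRing) (ACR.fromCommutativeRing K)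
                           ι-morphism ι-equal?
    using (Polynomial; con; var; _:+_; _:*_; _:-_; _:=_; ⟦_⟧↓; prove; solve)
    renaming (⟦_⟧ to ⟦_⟧ₚ)

  ι-nonzero : ∀ {u} → u ≢ 0ℚ → ι u ≉ 0#
  ι-nonzero {u} u≢0 ιu≈0 = proj₁ K-field (begin
    1#                  ≈⟨ 1#-homo ⟨
    ι 1ℚ                ≡⟨ cong ι (ℚₚ.*-inverseʳ u) ⟨
    ι (u ℚ.* ℚ.1/ u)    ≈⟨ *-homo u (ℚ.1/ u) ⟩
    ι u * ι (ℚ.1/ u)    ≈⟨ *-congʳ ιu≈0 ⟩
    0# * ι (ℚ.1/ u)     ≈⟨ zeroˡ _ ⟩
    0#                  ∎)
    where instance _ = ℚ.≢-nonZero u≢0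

  ι-injective : ∀ {u v} → ι u ≈ ι v → u ≡ v
  ι-injective {u} {v} ιu≈ιv = ℚRing.x∙y⁻¹≈ε⇒x≈y u v
    (decidable-stable (u ℚ.- v ℚₚ.≟ 0ℚ) λ u-v≢0 → ι-nonzero u-v≢0 (begin
      ι (u ℚ.- v)      ≈⟨ +-homo u (ℚ.- v) ⟩
      ι u + ι (ℚ.- v)  ≈⟨ +-congˡ (-‿homo v) ⟩
      ι u - ι v        ≈⟨ x≈y⇒x∙y⁻¹≈ε ιu≈ιv ⟩
      0#               ∎))
    where module ℚRing = RingProperties (CommutativeRing.ring ℚₚ.+-*-commutativeRing)

  ι≈0⇒≡0 : ∀ {u} → ι u ≈ 0# → u ≡ 0ℚ
  ι≈0⇒≡0 ιu≈0 = ι-injective (trans ιu≈0 (sym 0#-homo))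

  x*y≈0⇒y≈0 : ∀ {x y} → x ≉ 0# → x * y ≈ 0# → y ≈ 0#
  x*y≈0⇒y≈0 {x} {y} x≉0 xy≈0 with proj₂ K-field x x≉0
  ... | x⁻¹ , xx⁻¹≈1 = begin
    y              ≈⟨ *-identityˡ y ⟨
    1# * y         ≈⟨ *-congʳ xx⁻¹≈1 ⟨
    x * x⁻¹ * y    ≈⟨ *-congʳ (*-comm x x⁻¹) ⟩
    x⁻¹ * x * y    ≈⟨ *-assoc x⁻¹ x y ⟩
    x⁻¹ * (x * y)  ≈⟨ *-congˡ xy≈0 ⟩
    x⁻¹ * 0#       ≈⟨ zeroʳ x⁻¹ ⟩
    0#             ∎

  cancel-difference : ∀ {x z m p p′} → x ≉ z → (x - z) * m ≈ p - p′ → p ≈ p′ → m ≈ 0#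
  cancel-difference {x} {z} x≉z factorisation p≈p′ =
    x*y≈0⇒y≈0 (x≉z ∘ x∙y⁻¹≈ε⇒x≈y x z) (trans factorisation (x≈y⇒x∙y⁻¹≈ε p≈p′))

  ⟦_⟧ : Expr → (Fin 4 → Carrier) → Carrier
  ⟦ e ⟧ u = eval K ι u e

  ⟦-ᵉ⟧ : ∀ u e f → ⟦ e -ᵉ f ⟧ u ≈ ⟦ e ⟧ u - ⟦ f ⟧ u
  ⟦-ᵉ⟧ u e f = solve 2 (λ x y → x :+ con (ℚ.- 1ℚ) :* y := x :- y) refl (⟦ e ⟧ u) (⟦ f ⟧ u)

  ⟦⟧-cong : ∀ {u v} → (∀ i → u i ≈ v i) → ∀ e → ⟦ e ⟧ u ≈ ⟦ e ⟧ v
  ⟦⟧-cong u≈v (const q) = refl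
  ⟦⟧-cong u≈v (var i)   = u≈v i
  ⟦⟧-cong u≈v (e ⊕ f)   = +-cong (⟦⟧-cong u≈v e) (⟦⟧-cong u≈v f)
  ⟦⟧-cong u≈v (e ⊗ f)   = *-cong (⟦⟧-cong u≈v e) (⟦⟧-cong u≈v f)

  ⟦rename⟧ : ∀ u π e → ⟦ rename π e ⟧ u ≡ ⟦ e ⟧ (u ∘ π)
  ⟦rename⟧ u π (const q) = ≡.refl
  ⟦rename⟧ u π (var i)   = ≡.refl
  ⟦rename⟧ u π (e ⊕ f)   = cong₂ _+_ (⟦rename⟧ u π e) (⟦rename⟧ u π f)
  ⟦rename⟧ u π (e ⊗ f)   = cong₂ _*_ (⟦rename⟧ u π e) (⟦rename⟧ u π f)

  private
    ⌜_⌝ : Expr → Polynomial 4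
    ⌜ const q ⌝ = con q
    ⌜ var i ⌝   = var i
    ⌜ e ⊕ f ⌝   = ⌜ e ⌝ :+ ⌜ f ⌝
    ⌜ e ⊗ f ⌝   = ⌜ e ⌝ :* ⌜ f ⌝

    ⟦⌜⌝⟧ : ∀ u e → ⟦ ⌜ e ⌝ ⟧ₚ (tabulate u) ≈ ⟦ e ⟧ u
    ⟦⌜⌝⟧ u (const q) = refl
    ⟦⌜⌝⟧ u (var i)   = reflexive (lookup∘tabulate u i)
    ⟦⌜⌝⟧ u (e ⊕ f)   = +-cong (⟦⌜⌝⟧ u e) (⟦⌜⌝⟧ u f)
    ⟦⌜⌝⟧ u (e ⊗ f)   = *-cong (⟦⌜⌝⟧ u e) (⟦⌜⌝⟧ u f)

  -- Provable by `λ _ → refl` whenever e and f have the same ring normal form.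
  _≋_ : Expr → Expr → Set (c Level.⊔ ℓ)
  e ≋ f = ∀ u → ⟦ ⌜ e ⌝ ⟧↓ (tabulate u) ≈ ⟦ ⌜ f ⌝ ⟧↓ (tabulate u)

  ⟦⟧-≋ : ∀ e f → e ≋ f → ∀ u → ⟦ e ⟧ u ≈ ⟦ f ⟧ u
  ⟦⟧-≋ e f e≋f u = begin
    ⟦ e ⟧ u                  ≈⟨ ⟦⌜⌝⟧ u e ⟨
    ⟦ ⌜ e ⌝ ⟧ₚ (tabulate u)  ≈⟨ prove (tabulate u) ⌜ e ⌝ ⌜ f ⌝ (e≋f u) ⟩
    ⟦ ⌜ f ⌝ ⟧ₚ (tabulate u)  ≈⟨ ⟦⌜⌝⟧ u f ⟩
    ⟦ f ⟧ u                  ∎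

  record Vieta (A₀ A₁ A₂ A₃ : ℚ) (u : Fin 4 → Carrier) : Set ℓ where
    constructor vieta
    field
      vieta₁ : ⟦ e₁ ⟧ u ≈ - ι A₃
      vieta₂ : ⟦ e₂ ⟧ u ≈ ι A₂
      vieta₃ : ⟦ e₃ ⟧ u ≈ - ι A₁
      vieta₄ : ⟦ e₄ ⟧ u ≈ ι A₀

  module _ {A₀ A₁ A₂ A₃ : ℚ} where

    Vieta-cong : ∀ {u v} → (∀ i → u i ≈ v i) → Vieta A₀ A₁ A₂ A₃ u → Vieta A₀ A₁ A₂ A₃ v
    Vieta-cong u≈v (vieta v₁ v₂ v₃ v₄) = vieta
      (trans (sym (⟦⟧-cong u≈v e₁)) v₁) (trans (sym (⟦⟧-cong u≈v e₂)) v₂)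
      (trans (sym (⟦⟧-cong u≈v e₃)) v₃) (trans (sym (⟦⟧-cong u≈v e₄)) v₄)

    Vieta-permute : ∀ u π → rename π e₁ ≋ e₁ × rename π e₂ ≋ e₂ × rename π e₃ ≋ e₃ × rename π e₄ ≋ e₄ →
                    Vieta A₀ A₁ A₂ A₃ u → Vieta A₀ A₁ A₂ A₃ (u ∘ π)
    Vieta-permute u π (s₁ , s₂ , s₃ , s₄) (vieta v₁ v₂ v₃ v₄) =
      vieta (symmetric e₁ s₁ v₁) (symmetric e₂ s₂ v₂) (symmetric e₃ s₃ v₃) (symmetric e₄ s₄ v₄)
      where
      symmetric : ∀ e {x} → rename π e ≋ e → ⟦ e ⟧ u ≈ x → ⟦ e ⟧ (u ∘ π) ≈ x
      symmetric e s v = trans (reflexive (≡.sym (⟦rename⟧ u π e))) (trans (⟦⟧-≋ (rename π e) e s u) v)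

    Vieta-listing : ∀ {a b c u} → FourCycle a b c → Vieta A₀ A₁ A₂ A₃ u → Vieta A₀ A₁ A₂ A₃ (u ∘ listing a b c)
    Vieta-listing {u = u} ⟨0123⟩ =
      Vieta-permute u (listing 1F 2F 3F) ((λ _ → refl) , (λ _ → refl) , (λ _ → refl) , (λ _ → refl))
    Vieta-listing {u = u} ⟨0132⟩ =
      Vieta-permute u (listing 1F 3F 2F) ((λ _ → refl) , (λ _ → refl) , (λ _ → refl) , (λ _ → refl))
    Vieta-listing {u = u} ⟨0213⟩ =
      Vieta-permute u (listing 2F 1F 3F) ((λ _ → refl) , (λ _ → refl) , (λ _ → refl) , (λ _ → refl))
    Vieta-listing {u = u} ⟨0231⟩ =
      Vieta-permute u (listing 2F 3F 1F) ((λ _ → refl) , (λ _ → refl) , (λ _ → refl) , (λ _ → refl))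
    Vieta-listing {u = u} ⟨0312⟩ =
      Vieta-permute u (listing 3F 1F 2F) ((λ _ → refl) , (λ _ → refl) , (λ _ → refl) , (λ _ → refl))
    Vieta-listing {u = u} ⟨0321⟩ =
      Vieta-permute u (listing 3F 2F 1F) ((λ _ → refl) , (λ _ → refl) , (λ _ → refl) , (λ _ → refl))

    -- With roots x, y, x, y the quartic is (X² − sX + p)² for s = x + y = −A₃/2 and p = xy = (A₂ − s²)/2.
    module DoubleRootPair {x y : Carrier} (v : Vieta A₀ A₁ A₂ A₃ (lookup (x ∷ y ∷ x ∷ y ∷ []))) where

      open Vieta v

      s p : ℚ
      s = ℚ.- A₃ ℚ.* ½
      p = (A₂ ℚ.- s ℚ.* s) ℚ.* ½

      ιs≈x+y : ι s ≈ x + y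
      ιs≈x+y = begin
        ι (ℚ.- A₃ ℚ.* ½)       ≈⟨ *-homo (ℚ.- A₃) ½ ⟩
        ι (ℚ.- A₃) * ι ½       ≈⟨ *-congʳ (trans (-‿homo A₃) (sym vieta₁)) ⟩
        (x + y + x + y) * ι ½  ≈⟨ solve 2 (λ x y → (x :+ y :+ x :+ y) :* con ½ := x :+ y) refl x y ⟩
        x + y                  ∎

      ιp≈xy : ι p ≈ x * y
      ιp≈xy = begin
        ι ((A₂ ℚ.- s ℚ.* s) ℚ.* ½)  ≈⟨ *-homo _ ½ ⟩
        ι (A₂ ℚ.- s ℚ.* s) * ι ½
          ≈⟨ *-congʳ (trans (+-homo A₂ _) (+-congˡ (trans (-‿homo _) (-‿cong (*-homo s s))))) ⟩
        (ι A₂ - ι s * ι s) * ι ½    ≈⟨ *-congʳ (+-cong (sym vieta₂) (-‿cong (*-cong ιs≈x+y ιs≈x+y))) ⟩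
        (x * y + x * x + x * y + y * x + y * y + x * y - (x + y) * (x + y)) * ι ½
          ≈⟨ solve 2 (λ x y → (x :* y :+ x :* x :+ x :* y :+ y :* x :+ y :* y :+ x :* y :- (x :+ y) :* (x :+ y))
                              :* con ½ := x :* y) refl x y ⟩
        x * y                       ∎

      A₀≡p² : A₀ ≡ p ℚ.* p
      A₀≡p² = ι-injective (begin
        ι A₀               ≈⟨ vieta₄ ⟨
        x * y * x * y      ≈⟨ solve 2 (λ x y → x :* y :* x :* y := (x :* y) :* (x :* y)) refl x y ⟩
        (x * y) * (x * y)  ≈⟨ *-cong ιp≈xy ιp≈xy ⟨
        ι p * ι p          ≈⟨ *-homo p p ⟨
        ι (p ℚ.* p)        ∎)

      A₁≡-2sp : A₁ ≡ ℚ.- ((s ℚ.+ s) ℚ.* p)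
      A₁≡-2sp = ι-injective (begin
        ι A₁                               ≈⟨ -‿involutive (ι A₁) ⟨
        - (- ι A₁)                         ≈⟨ -‿cong vieta₃ ⟨
        - (x * y * x + x * y * y + x * x * y + y * x * y)
          ≈⟨ -‿cong (solve 2 (λ x y → x :* y :* x :+ x :* y :* y :+ x :* x :* y :+ y :* x :* y
                                     := (x :+ y :+ (x :+ y)) :* (x :* y)) refl x y) ⟩
        - ((x + y + (x + y)) * (x * y))    ≈⟨ -‿cong (*-cong (+-cong ιs≈x+y ιs≈x+y) ιp≈xy) ⟨
        - ((ι s + ι s) * ι p)              ≈⟨ -‿cong (trans (*-homo _ p) (*-congʳ (+-homo s s))) ⟨
        - ι ((s ℚ.+ s) ℚ.* p)              ≈⟨ -‿homo _ ⟨
        ι (ℚ.- ((s ℚ.+ s) ℚ.* p))          ∎)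

      A₂≡s²+2p : A₂ ≡ s ℚ.* s ℚ.+ (p ℚ.+ p)
      A₂≡s²+2p = ι-injective (begin
        ι A₂                                 ≈⟨ vieta₂ ⟨
        x * y + x * x + x * y + y * x + y * y + x * y
          ≈⟨ solve 2 (λ x y → x :* y :+ x :* x :+ x :* y :+ y :* x :+ y :* y :+ x :* y
                             := (x :+ y) :* (x :+ y) :+ (x :* y :+ x :* y)) refl x y ⟩
        (x + y) * (x + y) + (x * y + x * y)  ≈⟨ +-cong (*-cong ιs≈x+y ιs≈x+y) (+-cong ιp≈xy ιp≈xy) ⟨
        ι s * ι s + (ι p + ι p)              ≈⟨ +-cong (*-homo s s) (+-homo p p) ⟨
        ι (s ℚ.* s) + ι (p ℚ.+ p)            ≈⟨ +-homo _ _ ⟨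
        ι (s ℚ.* s ℚ.+ (p ℚ.+ p))            ∎)

      A₃≡-2s : A₃ ≡ ℚ.- (s ℚ.+ s)
      A₃≡-2s = ι-injective (begin
        ι A₃                 ≈⟨ -‿involutive (ι A₃) ⟨
        - (- ι A₃)           ≈⟨ -‿cong vieta₁ ⟨
        - (x + y + x + y)    ≈⟨ -‿cong (solve 2 (λ x y → x :+ y :+ x :+ y := x :+ y :+ (x :+ y)) refl x y) ⟩
        - (x + y + (x + y))  ≈⟨ -‿cong (+-cong ιs≈x+y ιs≈x+y) ⟨
        - (ι s + ι s)        ≈⟨ -‿cong (+-homo s s) ⟨
        - ι (s ℚ.+ s)        ≈⟨ -‿homo _ ⟨
        ι (ℚ.- (s ℚ.+ s))    ∎)

      quartic≡quadratic² : A₀ ∷ A₁ ∷ A₂ ∷ A₃ ∷ 1ℚ ∷ [] ≡ quadratic² s p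
      quartic≡quadratic² = cong₂ _∷_ A₀≡p² (cong₂ _∷_ A₁≡-2sp (cong₂ _∷_ A₂≡s²+2p (cong₂ _∷_ A₃≡-2s ≡.refl)))

    ¬double-root-pair : Irreducibleℚ (A₀ ∷ A₁ ∷ A₂ ∷ A₃ ∷ 1ℚ ∷ []) → ∀ {u} → Vieta A₀ A₁ A₂ A₃ u →
                        u 0F ≈ u 2F → u 1F ≈ u 3F → ⊥
    ¬double-root-pair irreducible {u} v u₀≈u₂ u₁≈u₃ =
      ¬irreducible-quadratic² s p (subst Irreducibleℚ quartic≡quadratic² irreducible)
      where
      u≈xyxy : ∀ i → u i ≈ lookup (u 0F ∷ u 1F ∷ u 0F ∷ u 1F ∷ []) i
      u≈xyxy 0F = refl
      u≈xyxy 1F = refl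
      u≈xyxy 2F = sym u₀≈u₂
      u≈xyxy 3F = sym u₁≈u₃
      open DoubleRootPair (Vieta-cong u≈xyxy v)

  preserves-≈ : ∀ {u σ} → Preserves K ι u σ → ∀ e f → ⟦ e ⟧ u ≈ ⟦ f ⟧ u → ⟦ e ⟧ (u ∘ σ) ≈ ⟦ f ⟧ (u ∘ σ)
  preserves-≈ {u} {σ} preserves e f e≈f = x∙y⁻¹≈ε⇒x≈y _ _
    (trans (sym (⟦-ᵉ⟧ (u ∘ σ) e f)) (preserves (e -ᵉ f) (trans (⟦-ᵉ⟧ u e f) (x≈y⇒x∙y⁻¹≈ε e≈f))))

  Preserves-conjugate : ∀ {u σ} π τ → Preserves K ι u σ → σ ∘ π ≗ π ∘ τ → Preserves K ι (u ∘ π) τ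
  Preserves-conjugate {u} {σ} π τ preserves σπ≗πτ e e≈0 = begin
    ⟦ e ⟧ (u ∘ π ∘ τ)       ≈⟨ ⟦⟧-cong (λ i → reflexive (cong u (σπ≗πτ i))) e ⟨
    ⟦ e ⟧ (u ∘ σ ∘ π)       ≡⟨ ⟦rename⟧ (u ∘ σ) π e ⟨
    ⟦ rename π e ⟧ (u ∘ σ)  ≈⟨ preserves (rename π e) (trans (reflexive (⟦rename⟧ u π e)) e≈0) ⟩
    0#                      ∎

  -- u lists the roots along a 4-cycle of a relation-preserving permutation, which thus acts as `rotate`.
  record CyclicRoots (u : Fin 4 → Carrier) : Set ℓ where
    field
      rotate-preserves : Preserves K ι u rotate
      no-double-pair   : u 0F ≈ u 2F → u 1F ≈ u 3F → ⊥

  open CyclicRoots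

  rotated : ∀ {u} → CyclicRoots u → CyclicRoots (u ∘ rotate)
  rotated cyclic = record
    { rotate-preserves = Preserves-conjugate rotate rotate (rotate-preserves cyclic) (λ _ → ≡.refl)
    ; no-double-pair   = λ u₁≈u₃ u₂≈u₀ → no-double-pair cyclic (sym u₂≈u₀) u₁≈u₃
    }

  shift : ∀ {u} → CyclicRoots u → ∀ {i j} → u i ≈ u j → u (rotate i) ≈ u (rotate j)
  shift cyclic {i} {j} = preserves-≈ (rotate-preserves cyclic) (X i) (X j)

  opposite-distinct : ∀ {u} → CyclicRoots u → u 0F ≉ u 2F
  opposite-distinct cyclic u₀≈u₂ = no-double-pair cyclic u₀≈u₂ (shift cyclic u₀≈u₂)

  neighbour-distinct : ∀ {u} → CyclicRoots u → u 0F ≉ u 3F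
  neighbour-distinct cyclic u₀≈u₃ =
    opposite-distinct cyclic (trans (shift cyclic (sym u₀≈u₃)) (shift cyclic (shift cyclic (sym u₀≈u₃))))

  pairing-irrational : ∀ {u} → CyclicRoots u → ∀ q → ⟦ pairing 0F 1F 2F 3F ⟧ u ≉ ι q
  pairing-irrational {u} cyclic q θ≈q = opposite-distinct (rotated cyclic) (x∙y⁻¹≈ε⇒x≈y _ _
    (cancel-difference (opposite-distinct cyclic)
      (solve 4 (λ x y z w → (x :- z) :* (y :- w) := x :* y :+ z :* w :- (y :* z :+ w :* x))
             refl (u 0F) (u 1F) (u 2F) (u 3F))
      (trans θ≈q (sym (preserves-≈ (rotate-preserves cyclic) (pairing 0F 1F 2F 3F) (const q) θ≈q)))))

  dividedDifference-vanishes : ∀ {u} → CyclicRoots u → ∀ a b c →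
    ⟦ combination a b c 0F 1F ⟧ u ≈ 0# → ⟦ dividedDifference b c 0F 1F 2F ⟧ u ≈ 0#
  dividedDifference-vanishes {u} cyclic a b c ℓ≈0 = cancel-difference (opposite-distinct cyclic)
    (solve 6 (λ A B C x y z → (x :- z) :* (B :+ C :* (x :+ y :+ z))
                := A :+ B :* (x :+ y) :+ C :* (x :* x :+ y :* y :+ x :* y)
                   :- (A :+ B :* (y :+ z) :+ C :* (y :* y :+ z :* z :+ y :* z)))
           refl (ι a) (ι b) (ι c) (u 0F) (u 1F) (u 2F))
    (trans ℓ≈0 (sym (rotate-preserves cyclic (combination a b c 0F 1F) ℓ≈0)))

  leading-coefficient-vanishes : ∀ {u} → CyclicRoots u → ∀ b c →
    ⟦ dividedDifference b c 0F 1F 2F ⟧ u ≈ 0# → ι c ≈ 0#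
  leading-coefficient-vanishes {u} cyclic b c d≈0 = cancel-difference (neighbour-distinct cyclic)
    (solve 6 (λ B C x y z w → (x :- w) :* C := B :+ C :* (x :+ y :+ z) :- (B :+ C :* (y :+ z :+ w)))
           refl (ι b) (ι c) (u 0F) (u 1F) (u 2F) (u 3F))
    (trans d≈0 (sym (rotate-preserves cyclic (dividedDifference b c 0F 1F 2F) d≈0)))

  combination-trivial : ∀ {u} → CyclicRoots u → ∀ a b c →
                        ⟦ combination a b c 0F 1F ⟧ u ≈ 0# → a ≡ 0ℚ × b ≡ 0ℚ × c ≡ 0ℚ
  combination-trivial {u} cyclic a b c ℓ≈0 = ι≈0⇒≡0 ιa≈0 , ι≈0⇒≡0 ιb≈0 , ι≈0⇒≡0 ιc≈0
    where
    absorb : ∀ {x y z} → z ≈ 0# → x + z * y ≈ x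
    absorb {x} {y} z≈0 = trans (+-congˡ (trans (*-congʳ z≈0) (zeroˡ y))) (+-identityʳ x)

    d≈0 : ⟦ dividedDifference b c 0F 1F 2F ⟧ u ≈ 0#
    d≈0 = dividedDifference-vanishes cyclic a b c ℓ≈0

    ιc≈0 : ι c ≈ 0#
    ιc≈0 = leading-coefficient-vanishes cyclic b c d≈0

    ιb≈0 : ι b ≈ 0#
    ιb≈0 = trans (sym (absorb ιc≈0)) d≈0

    ιa≈0 : ι a ≈ 0#
    ιa≈0 = trans (sym (trans (absorb ιc≈0) (absorb ιb≈0))) ℓ≈0

  combination-sym : ∀ u a b c i j → ⟦ combination a b c i j ⟧ u ≈ ⟦ combination a b c j i ⟧ u
  combination-sym u a b c i j =
    solve 5 (λ A B C x y → A :+ B :* (x :+ y) :+ C :* (x :* x :+ y :* y :+ x :* y)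
                        := A :+ B :* (y :+ x) :+ C :* (y :* y :+ x :* x :+ y :* x))
            refl (ι a) (ι b) (ι c) (u i) (u j)

  -- The pairing {{0,1},{2,3}} is either one of the two pairings interchanged by the cycle
  -- (0 a b c), or the one it fixes, and then 0 and 2 are neighbours on the cycle.
  in-cycle-order : ∀ r {a b c q} α β γ → FourCycle a b c → let u = r ∘ listing a b c in
    ⟦ pairing 0F 1F 2F 3F ⟧ r ≈ ι q → ⟦ combination α β γ 0F 2F ⟧ r ≈ 0# →
    ⟦ pairing 0F 1F 2F 3F ⟧ u ≈ ι q ⊎ ⟦ pairing 0F 1F 2F 3F ⟧ (u ∘ rotate) ≈ ι q ⊎
    ⟦ combination α β γ 0F 1F ⟧ u ≈ 0# ⊎ ⟦ combination α β γ 0F 1F ⟧ (u ∘ rotate ∘ rotate ∘ rotate) ≈ 0#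
  in-cycle-order _ _ _ _ ⟨0123⟩ θ≈q _ = inj₁ θ≈q
  in-cycle-order _ _ _ _ ⟨0132⟩ θ≈q _ = inj₁ (trans (+-congˡ (*-comm _ _)) θ≈q)
  in-cycle-order _ _ _ _ ⟨0213⟩ _ ℓ≈0 = inj₂ (inj₂ (inj₁ ℓ≈0))
  in-cycle-order _ _ _ _ ⟨0231⟩ θ≈q _ = inj₂ (inj₁ (trans (trans (+-comm _ _) (+-congʳ (*-comm _ _))) θ≈q))
  in-cycle-order r α β γ ⟨0312⟩ _ ℓ≈0 = inj₂ (inj₂ (inj₂ (trans (combination-sym r α β γ 2F 0F) ℓ≈0)))
  in-cycle-order _ _ _ _ ⟨0321⟩ θ≈q _ =
    inj₂ (inj₁ (trans (trans (+-comm _ _) (+-cong (*-comm _ _) (*-comm _ _))) θ≈q))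

  linearly-independent : ∀ {A₀ A₁ A₂ A₃ r q} a b c → Irreducibleℚ (A₀ ∷ A₁ ∷ A₂ ∷ A₃ ∷ 1ℚ ∷ []) →
    Vieta A₀ A₁ A₂ A₃ r → ∃ (λ σ → Preserves K ι r σ × HasOrder4 σ) →
    ⟦ pairing 0F 1F 2F 3F ⟧ r ≈ ι q → ⟦ combination a b c 0F 2F ⟧ r ≈ 0# → a ≡ 0ℚ × b ≡ 0ℚ × c ≡ 0ℚ
  linearly-independent {r = r} a b c irreducible v (σ , σ-preserves , σ-order4) θ≈q ℓ≈0 =
    [ ⊥-elim ∘ pairing-irrational cyclic _
    , [ ⊥-elim ∘ pairing-irrational (rotated cyclic) _
      , [ combination-trivial cyclic a b c
        , combination-trivial (rotated (rotated (rotated cyclic))) a b c ]′ ]′ ]′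
    (in-cycle-order r a b c cycle θ≈q ℓ≈0)
    where
    cycle : FourCycle (σ 0F) (σ (σ 0F)) (σ (σ (σ 0F)))
    cycle = order4⇒fourCycle σ σ-order4

    π : Fin 4 → Fin 4
    π = listing (σ 0F) (σ (σ 0F)) (σ (σ (σ 0F)))

    cyclic : CyclicRoots (r ∘ π)
    cyclic = record
      { rotate-preserves = Preserves-conjugate π rotate σ-preserves (order4⇒conjugate σ σ-order4)
      ; no-double-pair   = ¬double-root-pair irreducible {r ∘ π} (Vieta-listing {u = r} cycle v)
      }

lemma5p12 : ∀ {c ℓ : Level} (K : CommutativeRing c ℓ) → IsField K
  → (ι : ℚ → CommutativeRing.Carrier K) → IsRingHomFromℚ K ι
  → (a0 a1 a2 a3 : ℤ) → Irreducibleℚ (quartic a0 a1 a2 a3)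
  → (r : Fin 4 → CommutativeRing.Carrier K)
  → let open CommutativeRing K
        r₁ = r fz
        r₂ = r (fs fz)
        r₃ = r (fs (fs fz))
        r₄ = r (fs (fs (fs fz)))
    in r₁ + r₂ + r₃ + r₄ ≈ - ι (a3 Data.Rational./ 1)
    → r₁ * r₂ + r₁ * r₃ + r₁ * r₄ + r₂ * r₃ + r₂ * r₄ + r₃ * r₄ ≈ ι (a2 Data.Rational./ 1)
    → r₁ * r₂ * r₃ + r₁ * r₂ * r₄ + r₁ * r₃ * r₄ + r₂ * r₃ * r₄ ≈ - ι (a1 Data.Rational./ 1)
    → r₁ * r₂ * r₃ * r₄ ≈ ι (a0 Data.Rational./ 1)
    → (GalIso K ι r (Fin 4) C4op ⊎ GalIso K ι r (Fin 4 × Bool) D4op)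
    → ∃ (λ q → r₁ * r₂ + r₃ * r₄ ≈ ι q)
    → ∀ (a b c : ℚ)
    → ι a + ι b * (r₁ + r₃) + ι c * (r₁ * r₁ + r₃ * r₃ + r₁ * r₃) ≈ 0#
    → (a ≡ 0ℚ) × (b ≡ 0ℚ) × (c ≡ 0ℚ)
lemma5p12 K K-field ι ι-hom a0 a1 a2 a3 irreducible r v₁ v₂ v₃ v₄ galois (q , θ≈q) a b c ℓ≈0 =
  linearly-independent K K-field ι ι-hom a b c irreducible (vieta v₁ v₂ v₃ v₄)
    (C4⊎D4⇒order-4-element K ι galois) θ≈q ℓ≈0
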